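{- Let $D=(X,\mathcal{B})$ be a $2$-$(v,k,\lambda)$ design. Then $$\gamma(D)\geq \left\lceil\frac{2v-1-\frac{k-1}{\lambda}}{k}\right\rceil.$$
   Context: Let $v,k,\lambda$ be positive integers with $v\geq k\geq 2$. A $2$-$(v,k,\lambda)$ design $D=(X,\mathcal{B})$ consists of a set $X$ of $v$ points and a family $\mathcal{B}$ of $k$-subsets of $X$ (blocks) such that every pair of distinct points is contained in exactly $\lambda$ blocks. The incidence graph $G_D$ is the bipartite graph with vertex set $X\cup\mathcal{B}$ in which a point $x$ is adjacent to a block $B$ iff $x\in B$. A dominating set of a graph is a set $S$ of vertices such that every vertex not in $S$ is adjacent to some vertex of $S$; $\gamma(D)$ denotes the minimum size of a dominating set of $G_D$. -}

module Defs where

open import Data.Nat using (ℕ; _+_; _≤_)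
open import Data.Fin using (Fin)
open import Data.Fin.Subset using (Subset; _∈_; _∉_; ∣_∣)
open import Data.Fin.Subset.Properties using (_∈?_)
open import Data.List using (List; length; filter; allFin)
open import Data.Product using (_×_; ∃-syntax)
open import Relation.Nullary.Decidable using (_×-dec_)
open import Relation.Binary.PropositionalEquality using (_≡_)
open import Relation.Nullary using (¬_)

-- A family of b blocks on the point set Fin v: block j is the subset B j.
-- (Blocks are indexed, so repeated blocks are allowed, as in a family.)
Blocks : ℕ → ℕ → Set
Blocks v b = Fin b → Subset v

pairCount : ∀ {v b} → Blocks v b → Fin v → Fin v → ℕ
pairCount {v} {b} B x y = length (filter (λ j → (x ∈? B j) ×-dec (y ∈? B j)) (allFin b))

Is2Design : ∀ {v b} → ℕ → ℕ → Blocks v b → Set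
Is2Design {v} {b} k λ' B =
  ((j : Fin b) → ∣ B j ∣ ≡ k) ×
  ((x y : Fin v) → ¬ (x ≡ y) → pairCount B x y ≡ λ')

-- A dominating set of the incidence graph G_D, given as a set S of points
-- together with a set T of blocks (indices): every point outside S lies in
-- some block of T, and every block outside T contains some point of S.
IsDominating : ∀ {v b} → Blocks v b → Subset v → Subset b → Set
IsDominating {v} {b} B S T =
  ((x : Fin v) → x ∉ S → ∃[ j ] (j ∈ T × x ∈ B j)) ×
  ((j : Fin b) → j ∉ T → ∃[ x ] (x ∈ S × x ∈ B j))

domSize : ∀ {v b} → Subset v → Subset b → ℕ
domSize S T = ∣ S ∣ + ∣ T ∣

-- Let s = ∣S∣ and t = ∣T∣. Every point outside S lies in a block of T, so counting
-- incidences with blocks of T gives v ≤ s + t k. If some x ∉ S lies in at most one block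
-- of T (x is singly covered), each of the r blocks through x is either that block or,
-- being dominated, meets S; hence r ≤ 1 + s λ, and with r (k − 1) = (v − 1) λ this yields
-- (2v − 1) λ ≤ (s + t) k λ + k − 1. Otherwise every point outside S lies in two blocks
-- of T, so 2v ≤ 2s + t k ≤ k (s + t).
module Submission where

open import Defs
open import Algebra.Properties.Semiring.Sum as Sum using ()
open import Data.Bool using (true; false; if_then_else_)
open import Data.Fin using (Fin; zero; suc; punchIn)
open import Data.Fin.Properties using (any?; punchInᵢ≢i)
open import Data.Fin.Subset using (Subset; _∈_; _∉_; ∣_∣)
open import Data.Fin.Subset.Properties using (_∈?_)
open import Data.List using (length; filter; tabulate)
open import Data.Nat using (ℕ; zero; suc; _+_; _*_; _∸_; _≤_; z≤n; s≤s; _≤?_; NonZero)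
open import Data.Nat.Properties
open import Data.Nat.Solver using (module +-*-Solver)
open import Data.Product using (_×_; _,_; ∃-syntax)
open import Data.Vec using ([]; _∷_)
open import Function using (_∘_; id)
open import Relation.Binary.PropositionalEquality
open import Relation.Nullary using (Dec; yes; no; ¬?; does)
open import Relation.Nullary.Decidable using (_×-dec_)
open import Relation.Nullary.Negation using (contradiction)

open Sum +-*-semiring using (sum; sum-syntax; sum-cong-≗; ∑-distrib-+; ∑-comm; *-distribˡ-sum; *-distribʳ-sum; sum-remove)

𝟙 : ∀ {a} {P : Set a} → Dec P → ℕ
𝟙 d = if does d then 1 else 0

𝟙-yes : ∀ {a} {P : Set a} (d : Dec P) → P → 𝟙 d ≡ 1
𝟙-yes (yes _) _  = refl
𝟙-yes (no ¬p) p = contradiction p ¬p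

𝟙-×-dec : ∀ {a b} {P : Set a} {Q : Set b} (d : Dec P) (e : Dec Q) → 𝟙 (d ×-dec e) ≡ 𝟙 d * 𝟙 e
𝟙-×-dec (yes _) (yes _) = refl
𝟙-×-dec (yes _) (no _)  = refl
𝟙-×-dec (no _)  _       = refl

𝟙-idem : ∀ {a} {P : Set a} (d : Dec P) → 𝟙 d * 𝟙 d ≡ 𝟙 d
𝟙-idem (yes _) = refl
𝟙-idem (no _)  = refl

sum-const : ∀ n c → sum {n} (λ _ → c) ≡ n * c
sum-const zero    c = refl
sum-const (suc n) c = cong (c +_) (sum-const n c)

sum-mono-≤ : ∀ {n} {f g : Fin n → ℕ} → (∀ i → f i ≤ g i) → sum f ≤ sum g
sum-mono-≤ {zero}  f≤g = z≤n
sum-mono-≤ {suc n} f≤g = +-mono-≤ (f≤g zero) (sum-mono-≤ (f≤g ∘ suc))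

term≤sum : ∀ {n} (f : Fin n → ℕ) i → f i ≤ sum f
term≤sum {suc n} f i = ≤-trans (m≤m+n (f i) _) (≤-reflexive (sym (sum-remove {i = i} f)))

sum-except : ∀ {n} (f : Fin n → ℕ) x c → (∀ y → y ≢ x → f y ≡ c) → sum f ≡ f x + (n ∸ 1) * c
sum-except {suc n} f x c f≡c = begin
  sum f                      ≡⟨ sum-remove {i = x} f ⟩
  f x + sum (f ∘ punchIn x)  ≡⟨ cong (f x +_) (sum-cong-≗ (λ y → f≡c _ (punchInᵢ≢i x y))) ⟩
  f x + sum {n} (λ _ → c)    ≡⟨ cong (f x +_) (sum-const n c) ⟩
  f x + n * c                ∎
  where open ≡-Reasoning

∣p∣≡∑𝟙 : ∀ {n} (p : Subset n) → ∣ p ∣ ≡ sum (λ x → 𝟙 (x ∈? p))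
∣p∣≡∑𝟙 []          = refl
∣p∣≡∑𝟙 (true ∷ p)  = cong suc (∣p∣≡∑𝟙 p)
∣p∣≡∑𝟙 (false ∷ p) = ∣p∣≡∑𝟙 p

length-filter≡∑𝟙 : ∀ {a} {A : Set} {P : A → Set a} (P? : ∀ x → Dec (P x)) {n} (f : Fin n → A) →
  length (filter P? (tabulate f)) ≡ sum (λ i → 𝟙 (P? (f i)))
length-filter≡∑𝟙 P? {zero}  f = refl
length-filter≡∑𝟙 P? {suc n} f with P? (f zero)
... | yes _ = cong suc (length-filter≡∑𝟙 P? (f ∘ suc))
... | no _  = length-filter≡∑𝟙 P? (f ∘ suc)

-- s, t stand for ∣S∣, ∣T∣ and r for the replication number of a singly covered point.
singly-covered-bound : ∀ {v k l s t r} → 1 ≤ k →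
  v * 1 ≤ s * 1 + t * k → r ≤ 1 + s * l → r * k ≡ r + (v ∸ 1) * l →
  2 * v * l ≤ l + ((s + t) * (l * k) + (k ∸ 1))
singly-covered-bound {zero} _ _ _ _ = z≤n
singly-covered-bound {suc v} {suc k} {l} {s} {t} {r} _ v≤s+tk r≤1+sl rk≡r+vl = begin
  2 * suc v * l                              ≡⟨ solve 3 (λ v l k → (con 2 :* (con 1 :+ v)) :* l
                                                  := l :+ ((con 1 :+ v) :* con 1 :* l :+ v :* l)) refl v l k ⟩
  l + (suc v * 1 * l + v * l)                ≤⟨ +-monoʳ-≤ l (+-mono-≤ (*-monoˡ-≤ l v≤s+tk) vl≤[1+sl]k) ⟩
  l + ((s * 1 + t * suc k) * l + (1 + s * l) * k)
                                             ≡⟨ solve 4 (λ s t l k → l :+ ((s :* con 1 :+ t :* (con 1 :+ k)) :* l :+ (con 1 :+ s :* l) :* k)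
                                                  := l :+ ((s :+ t) :* (l :* (con 1 :+ k)) :+ k)) refl s t l k ⟩
  l + ((s + t) * (l * suc k) + k)            ∎
  where
  open ≤-Reasoning
  open +-*-Solver
  rk≡vl : r * k ≡ v * l
  rk≡vl = +-cancelˡ-≡ r _ _ (trans (sym (*-suc r k)) rk≡r+vl)
  vl≤[1+sl]k : v * l ≤ (1 + s * l) * k
  vl≤[1+sl]k = subst (_≤ (1 + s * l) * k) rk≡vl (*-monoˡ-≤ k r≤1+sl)

doubly-covered-bound : ∀ {v k l s t} → 2 ≤ k →
  v * 2 ≤ s * 2 + t * k → 2 * v * l ≤ l + ((s + t) * (l * k) + (k ∸ 1))
doubly-covered-bound {v} {k} {l} {s} {t} 2≤k 2v≤2s+tk = begin
  2 * v * l                      ≡⟨ cong (_* l) (*-comm 2 v) ⟩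
  v * 2 * l                      ≤⟨ *-monoˡ-≤ l (≤-trans 2v≤2s+tk (+-monoˡ-≤ (t * k) (*-monoʳ-≤ s 2≤k))) ⟩
  (s * k + t * k) * l            ≡⟨ solve 4 (λ s t k l → (s :* k :+ t :* k) :* l := (s :+ t) :* (l :* k)) refl s t k l ⟩
  (s + t) * (l * k)              ≤⟨ m≤m+n _ (k ∸ 1) ⟩
  (s + t) * (l * k) + (k ∸ 1)    ≤⟨ m≤n+m _ l ⟩
  l + ((s + t) * (l * k) + (k ∸ 1)) ∎
  where
  open ≤-Reasoning
  open +-*-Solver

module Incidence {v b : ℕ} (B : Blocks v b) where

  replication : Fin v → ℕ
  replication x = ∑[ j < b ] 𝟙 (x ∈? B j)

  pairCount≡∑ : ∀ x y → pairCount B x y ≡ ∑[ j < b ] (𝟙 (x ∈? B j) * 𝟙 (y ∈? B j))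
  pairCount≡∑ x y = trans (length-filter≡∑𝟙 (λ j → (x ∈? B j) ×-dec (y ∈? B j)) id)
                          (sum-cong-≗ (λ j → 𝟙-×-dec (x ∈? B j) (y ∈? B j)))

  pairCount-diag : ∀ x → pairCount B x x ≡ replication x
  pairCount-diag x = trans (pairCount≡∑ x x) (sum-cong-≗ (λ j → 𝟙-idem (x ∈? B j)))

module Design {v b k λ' : ℕ} {B : Blocks v b}
  (blockSize : ∀ j → ∣ B j ∣ ≡ k)
  (balanced : ∀ x y → x ≢ y → pairCount B x y ≡ λ') where

  open Incidence B public

  ∑∈B≡k : ∀ j → ∑[ y < v ] 𝟙 (y ∈? B j) ≡ k
  ∑∈B≡k j = trans (sym (∣p∣≡∑𝟙 (B j))) (blockSize j)

  replication-count : ∀ x → replication x * k ≡ replication x + (v ∸ 1) * λ'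
  replication-count x = begin
    replication x * k                                    ≡⟨ *-distribʳ-sum {b} k _ ⟩
    ∑[ j < b ] (𝟙x j * k)                                ≡⟨ sum-cong-≗ (λ j → cong (𝟙x j *_) (sym (∑∈B≡k j))) ⟩
    ∑[ j < b ] (𝟙x j * (∑[ y < v ] 𝟙 (y ∈? B j)))        ≡⟨ sum-cong-≗ (λ j → *-distribˡ-sum {v} (𝟙x j) _) ⟩
    ∑[ j < b ] ∑[ y < v ] (𝟙x j * 𝟙 (y ∈? B j))          ≡⟨ ∑-comm (λ j y → 𝟙x j * 𝟙 (y ∈? B j)) ⟩
    ∑[ y < v ] ∑[ j < b ] (𝟙x j * 𝟙 (y ∈? B j))          ≡⟨ sum-cong-≗ (λ y → sym (pairCount≡∑ x y)) ⟩
    sum (pairCount B x)                                  ≡⟨ sum-except (pairCount B x) x λ' (λ y y≢x → balanced x y (y≢x ∘ sym)) ⟩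
    pairCount B x x + (v ∸ 1) * λ'                       ≡⟨ cong (_+ (v ∸ 1) * λ') (pairCount-diag x) ⟩
    replication x + (v ∸ 1) * λ'                         ∎
    where
    open ≡-Reasoning
    𝟙x : Fin b → ℕ
    𝟙x j = 𝟙 (x ∈? B j)

  ∑S-pairCount≡∣S∣*λ : ∀ {S : Subset v} {x} → x ∉ S → ∑[ y < v ] (𝟙 (y ∈? S) * pairCount B x y) ≡ ∣ S ∣ * λ'
  ∑S-pairCount≡∣S∣*λ {S} {x} x∉S = begin
    ∑[ y < v ] (𝟙 (y ∈? S) * pairCount B x y)  ≡⟨ sum-cong-≗ pairCount-from-S ⟩
    ∑[ y < v ] (𝟙 (y ∈? S) * λ')               ≡⟨ *-distribʳ-sum {v} λ' _ ⟨
    (∑[ y < v ] 𝟙 (y ∈? S)) * λ'               ≡⟨ cong (_* λ') (∣p∣≡∑𝟙 S) ⟨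
    ∣ S ∣ * λ'                                 ∎
    where
    open ≡-Reasoning
    pairCount-from-S : ∀ y → 𝟙 (y ∈? S) * pairCount B x y ≡ 𝟙 (y ∈? S) * λ'
    pairCount-from-S y with y ∈? S
    ... | yes y∈S = cong (1 *_) (balanced x y (λ x≡y → x∉S (subst (_∈ S) (sym x≡y) y∈S)))
    ... | no _    = refl

  module Dominating {S : Subset v} {T : Subset b}
    (covered : ∀ x → x ∉ S → ∃[ j ] (j ∈ T × x ∈ B j))
    (hit : ∀ j → j ∉ T → ∃[ x ] (x ∈ S × x ∈ B j)) where

    coverDegree : Fin v → ℕ
    coverDegree x = ∑[ j < b ] (𝟙 (j ∈? T) * 𝟙 (x ∈? B j))

    ∑coverDegree≡∣T∣*k : sum coverDegree ≡ ∣ T ∣ * k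
    ∑coverDegree≡∣T∣*k = begin
      ∑[ x < v ] ∑[ j < b ] (𝟙 (j ∈? T) * 𝟙 (x ∈? B j))   ≡⟨ ∑-comm (λ x j → 𝟙 (j ∈? T) * 𝟙 (x ∈? B j)) ⟩
      ∑[ j < b ] ∑[ x < v ] (𝟙 (j ∈? T) * 𝟙 (x ∈? B j))   ≡⟨ sum-cong-≗ (λ j → sym (*-distribˡ-sum {v} (𝟙 (j ∈? T)) _)) ⟩
      ∑[ j < b ] (𝟙 (j ∈? T) * (∑[ x < v ] 𝟙 (x ∈? B j))) ≡⟨ sum-cong-≗ (λ j → cong (𝟙 (j ∈? T) *_) (∑∈B≡k j)) ⟩
      ∑[ j < b ] (𝟙 (j ∈? T) * k)                         ≡⟨ *-distribʳ-sum {b} k _ ⟨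
      (∑[ j < b ] 𝟙 (j ∈? T)) * k                         ≡⟨ cong (_* k) (∣p∣≡∑𝟙 T) ⟨
      ∣ T ∣ * k                                            ∎
      where open ≡-Reasoning

    coverDegree-pos : ∀ {x j} → j ∈ T → x ∈ B j → 1 ≤ coverDegree x
    coverDegree-pos {x} {j} j∈T x∈Bj = begin
      1                               ≡⟨ cong₂ _*_ (𝟙-yes (j ∈? T) j∈T) (𝟙-yes (x ∈? B j) x∈Bj) ⟨
      𝟙 (j ∈? T) * 𝟙 (x ∈? B j)      ≤⟨ term≤sum (λ j → 𝟙 (j ∈? T) * 𝟙 (x ∈? B j)) j ⟩
      coverDegree x                   ∎
      where open ≤-Reasoning

    covering-count : ∀ c → (∀ x → x ∉ S → c ≤ coverDegree x) → v * c ≤ ∣ S ∣ * c + ∣ T ∣ * k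
    covering-count c deg≥c = begin
      v * c                                           ≡⟨ sum-const v c ⟨
      ∑[ x < v ] c                                    ≤⟨ sum-mono-≤ pointwise ⟩
      ∑[ x < v ] (𝟙 (x ∈? S) * c + coverDegree x)     ≡⟨ ∑-distrib-+ (λ x → 𝟙 (x ∈? S) * c) coverDegree ⟩
      ∑[ x < v ] (𝟙 (x ∈? S) * c) + sum coverDegree   ≡⟨ cong₂ _+_ (sym (*-distribʳ-sum {v} c _)) ∑coverDegree≡∣T∣*k ⟩
      (∑[ x < v ] 𝟙 (x ∈? S)) * c + ∣ T ∣ * k         ≡⟨ cong (λ n → n * c + ∣ T ∣ * k) (∣p∣≡∑𝟙 S) ⟨
      ∣ S ∣ * c + ∣ T ∣ * k                           ∎
      where
      open ≤-Reasoning
      pointwise : ∀ x → c ≤ 𝟙 (x ∈? S) * c + coverDegree x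
      pointwise x with x ∈? S
      ... | yes _  = ≤-trans (≤-reflexive (sym (+-identityʳ c))) (m≤m+n _ _)
      ... | no x∉S = deg≥c x x∉S

    replication≤coverDegree+∣S∣*λ : ∀ {x} → x ∉ S → replication x ≤ coverDegree x + ∣ S ∣ * λ'
    replication≤coverDegree+∣S∣*λ {x} x∉S = begin
      ∑[ j < b ] 𝟙x j                                                      ≤⟨ sum-mono-≤ blockwise ⟩
      ∑[ j < b ] (𝟙 (j ∈? T) * 𝟙x j + ∑[ y < v ] (𝟙 (y ∈? S) * 𝟙xy j y))  ≡⟨ ∑-distrib-+ (λ j → 𝟙 (j ∈? T) * 𝟙x j) _ ⟩
      coverDegree x + ∑[ j < b ] ∑[ y < v ] (𝟙 (y ∈? S) * 𝟙xy j y)         ≡⟨ cong (coverDegree x +_) (∑-comm (λ j y → 𝟙 (y ∈? S) * 𝟙xy j y)) ⟩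
      coverDegree x + ∑[ y < v ] ∑[ j < b ] (𝟙 (y ∈? S) * 𝟙xy j y)         ≡⟨ cong (coverDegree x +_) (sum-cong-≗ S-pairCount) ⟩
      coverDegree x + ∑[ y < v ] (𝟙 (y ∈? S) * pairCount B x y)            ≡⟨ cong (coverDegree x +_) (∑S-pairCount≡∣S∣*λ x∉S) ⟩
      coverDegree x + ∣ S ∣ * λ'                                           ∎
      where
      open ≤-Reasoning
      𝟙x : Fin b → ℕ
      𝟙x j = 𝟙 (x ∈? B j)
      𝟙xy : Fin b → Fin v → ℕ
      𝟙xy j y = 𝟙x j * 𝟙 (y ∈? B j)
      blockwise : ∀ j → 𝟙x j ≤ 𝟙 (j ∈? T) * 𝟙x j + ∑[ y < v ] (𝟙 (y ∈? S) * 𝟙xy j y)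
      blockwise j with j ∈? T | x ∈? B j
      ... | _      | no _  = z≤n
      ... | yes _  | yes _ = s≤s z≤n
      ... | no j∉T | yes _ with hit j j∉T
      ...   | y , y∈S , y∈Bj = begin
        1                                             ≡⟨ cong₂ _*_ (𝟙-yes (y ∈? S) y∈S) (cong (1 *_) (𝟙-yes (y ∈? B j) y∈Bj)) ⟨
        𝟙 (y ∈? S) * (1 * 𝟙 (y ∈? B j))               ≤⟨ term≤sum (λ y → 𝟙 (y ∈? S) * (1 * 𝟙 (y ∈? B j))) y ⟩
        ∑[ y < v ] (𝟙 (y ∈? S) * (1 * 𝟙 (y ∈? B j)))  ∎
      S-pairCount : ∀ y → ∑[ j < b ] (𝟙 (y ∈? S) * 𝟙xy j y) ≡ 𝟙 (y ∈? S) * pairCount B x y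
      S-pairCount y = trans (sym (*-distribˡ-sum {b} (𝟙 (y ∈? S)) _)) (cong (𝟙 (y ∈? S) *_) (sym (pairCount≡∑ x y)))

    domination-bound : 2 ≤ k → 2 * v * λ' ≤ λ' + ((∣ S ∣ + ∣ T ∣) * (λ' * k) + (k ∸ 1))
    domination-bound 2≤k with any? (λ x → ¬? (x ∈? S) ×-dec (coverDegree x ≤? 1))
    ... | yes (x , x∉S , deg≤1) = singly-covered-bound {v} {k} {λ'} {∣ S ∣} {∣ T ∣} (≤-trans (s≤s z≤n) 2≤k)
            (covering-count 1 (λ y y∉S → let (j , j∈T , y∈Bj) = covered y y∉S in coverDegree-pos j∈T y∈Bj))
            (≤-trans (replication≤coverDegree+∣S∣*λ x∉S) (+-monoˡ-≤ _ deg≤1))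
            (replication-count x)
    ... | no ¬singly = doubly-covered-bound {v} {k} {λ'} {∣ S ∣} {∣ T ∣} 2≤k
            (covering-count 2 (λ x x∉S → ≰⇒> (λ deg≤1 → ¬singly (x , x∉S , deg≤1))))

open import Data.Integer as ℤ using (+_; +[1+_])
open import Data.Integer.DivMod using (a≡a%n+[a/n]*n; n%d<d)
import Data.Integer.Properties as ℤ
open import Data.Rational as ℚ using (mkℚ; ↥_; ↧_; _/_; _-_; floor; ceiling; toℚᵘ)
open import Data.Rational.Properties using (↥-neg; ↧-neg; toℚᵘ-homo-*; toℚᵘ-homo-+; toℚᵘ-homo‿-; toℚᵘ-fromℚᵘ)
open import Data.Rational.Unnormalised as ℚᵘ using (mkℚᵘ; *≤*)
import Data.Rational.Unnormalised.Properties as ℚᵘ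

/-greatest : ∀ {m} a d → m ℤ.* +[1+ d ] ℤ.≤ a → m ℤ.≤ a ℤ./ +[1+ d ]
/-greatest {m} a d md≤a with m ℤ.≤? a ℤ./ +[1+ d ]
... | yes m≤q = m≤q
... | no m≰q = contradiction md≤a (ℤ.<⇒≱ a<md)
  where
  D = +[1+ d ]
  q = a ℤ./ D
  a<md : a ℤ.< m ℤ.* D
  a<md = begin-strict
    a                          ≡⟨ a≡a%n+[a/n]*n a D ⟩
    + (a ℤ.% D) ℤ.+ q ℤ.* D    <⟨ ℤ.+-monoˡ-< (q ℤ.* D) (ℤ.+<+ (n%d<d a D)) ⟩
    D ℤ.+ q ℤ.* D              ≡⟨ cong (ℤ._+ q ℤ.* D) (ℤ.*-identityˡ D) ⟨
    ℤ.1ℤ ℤ.* D ℤ.+ q ℤ.* D     ≡⟨ ℤ.*-distribʳ-+ D ℤ.1ℤ q ⟨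
    ℤ.suc q ℤ.* D              ≤⟨ ℤ.*-monoʳ-≤-nonNeg D (ℤ.i<j⇒suc[i]≤j (ℤ.≰⇒> m≰q)) ⟩
    m ℤ.* D                    ∎
    where open ℤ.≤-Reasoning

floor-greatest : ∀ q {m} → m ℤ.* ↧ q ℤ.≤ ↥ q → m ℤ.≤ floor q
floor-greatest (mkℚ a d _) = /-greatest a d

ceiling-least : ∀ q {n} → toℚᵘ q ℚᵘ.≤ mkℚᵘ n 0 → ceiling q ℤ.≤ n
ceiling-least q@(mkℚ _ _ _) {n} (*≤* q≤n) =
  subst (ceiling q ℤ.≤_) (ℤ.neg-involutive n) (ℤ.neg-mono-≤ (floor-greatest (ℚ.- q) -n*↧≤↥))
  where
  -n*↧≤↥ : ℤ.- n ℤ.* ↧ (ℚ.- q) ℤ.≤ ↥ (ℚ.- q)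
  -n*↧≤↥ = subst₂ ℤ._≤_
    (trans (ℤ.neg-distribˡ-* n (↧ q)) (cong (ℤ.- n ℤ.*_) (sym (↧-neg q))))
    (trans (cong ℤ.-_ (ℤ.*-identityʳ (↥ q))) (sym (↥-neg q)))
    (ℤ.neg-mono-≤ q≤n)

ceiling-bound : ∀ A C n l k .{{_ : NonZero l}} .{{_ : NonZero k}} → A * l ≤ n * (l * k) + C →
  ceiling ((+ A / 1 - + C / l) ℚ.* (+ 1 / k)) ℤ.≤ + n
ceiling-bound A C n (suc l) (suc k) Al≤n[lk]+C = ceiling-least q (ℚᵘ.≤-respˡ-≃ (ℚᵘ.≃-sym q≃q′) (*≤* cross))
  where
  q = (+ A / 1 - + C / suc l) ℚ.* (+ 1 / suc k)
  -- In ℚᵘ no gcd normalisation happens, so the numerator and denominator of q′ compute.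
  q′ = (mkℚᵘ (+ A) 0 ℚᵘ.- mkℚᵘ (+ C) l) ℚᵘ.* mkℚᵘ (+ 1) k
  q≃q′ : toℚᵘ q ℚᵘ.≃ q′
  q≃q′ = ℚᵘ.≃-trans (toℚᵘ-homo-* (+ A / 1 - + C / suc l) (+ 1 / suc k))
    (ℚᵘ.*-cong (ℚᵘ.≃-trans (toℚᵘ-homo-+ (+ A / 1) (ℚ.- (+ C / suc l)))
                  (ℚᵘ.+-cong (toℚᵘ-fromℚᵘ (mkℚᵘ (+ A) 0))
                    (ℚᵘ.≃-trans (toℚᵘ-homo‿- (+ C / suc l)) (ℚᵘ.-‿cong (toℚᵘ-fromℚᵘ (mkℚᵘ (+ C) l))))))
               (toℚᵘ-fromℚᵘ (mkℚᵘ (+ 1) k)))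
  M = 1 * suc l * suc k
  Al≤nM+C : A * suc l ≤ n * M + C
  Al≤nM+C = subst (λ m → A * suc l ≤ n * m + C) (sym (trans (*-assoc 1 (suc l) (suc k)) (*-identityˡ _))) Al≤n[lk]+C
  cross : (+ A ℤ.* +[1+ l ] ℤ.+ ℤ.- + C ℤ.* ℤ.1ℤ) ℤ.* ℤ.1ℤ ℤ.* ℤ.1ℤ ℤ.≤ + n ℤ.* + M
  cross = begin
    (+ A ℤ.* +[1+ l ] ℤ.+ ℤ.- + C ℤ.* ℤ.1ℤ) ℤ.* ℤ.1ℤ ℤ.* ℤ.1ℤ
      ≡⟨ trans (ℤ.*-identityʳ _) (trans (ℤ.*-identityʳ _) (cong₂ ℤ._+_ (sym (ℤ.pos-* A (suc l))) (ℤ.*-identityʳ (ℤ.- + C)))) ⟩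
    + (A * suc l) ℤ.- + C                ≤⟨ ℤ.+-monoˡ-≤ (ℤ.- + C) (ℤ.+≤+ Al≤nM+C) ⟩
    + (n * M + C) ℤ.- + C                ≡⟨ cong (ℤ._- + C) (ℤ.pos-+ (n * M) C) ⟩
    + (n * M) ℤ.+ + C ℤ.- + C            ≡⟨ ℤ.+-assoc (+ (n * M)) (+ C) (ℤ.- + C) ⟩
    + (n * M) ℤ.+ (+ C ℤ.- + C)          ≡⟨ cong (ℤ._+_ (+ (n * M))) (ℤ.+-inverseʳ (+ C)) ⟩
    + (n * M) ℤ.+ ℤ.0ℤ                   ≡⟨ ℤ.+-identityʳ _ ⟩
    + (n * M)                            ≡⟨ ℤ.pos-* n M ⟩
    + n ℤ.* + M                          ∎
    where open ℤ.≤-Reasoning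

theorem1p4 : (v k λ' b : ℕ) → .{{_ : NonZero λ'}} → .{{_ : NonZero k}} →
    2 ≤ k → k ≤ v → (B : Blocks v b) → Is2Design k λ' B →
    (S : Subset v) → (T : Subset b) → IsDominating B S T →
    ceiling ((+ (2 * v ∸ 1) / 1 - + (k ∸ 1) / λ') ℚ.* (+ 1 / k)) ℤ.≤ + domSize S T
theorem1p4 v k λ' b 2≤k _ B (blockSize , balanced) S T (covered , hit) =
  ceiling-bound (2 * v ∸ 1) (k ∸ 1) (domSize S T) λ' k (begin
    (2 * v ∸ 1) * λ'                  ≡⟨ *-distribʳ-∸ λ' (2 * v) 1 ⟩
    2 * v * λ' ∸ 1 * λ'               ≡⟨ cong (2 * v * λ' ∸_) (*-identityˡ λ') ⟩
    2 * v * λ' ∸ λ'                   ≤⟨ m≤n+o⇒m∸n≤o _ λ' (domination-bound 2≤k) ⟩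
    domSize S T * (λ' * k) + (k ∸ 1)  ∎)
  where
  open Design blockSize balanced
  open Dominating covered hit
  open ≤-Reasoning
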